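{- Let $n,k,d$ be positive integers with $d\ge 2$ and $d\mid n$, and let $\Phi$ be a non-crossing forest on $n$ vertices with $k$ components which is invariant under rotation $\rho$ by $2\pi/d$. Then $\rho$ maps every tree (component) $\tau$ of $\Phi$ either onto itself or onto a different tree of $\Phi$ whose vertex set is disjoint from that of $\tau$. Moreover, a tree mapped onto itself can occur only if $d=2$ and $k$ is odd.
   Context: A non-crossing forest on $n$ vertices is a graph whose vertices $1,\dots,n$ are placed clockwise at the corners of a regular $n$-gon on a circle, whose edges are straight line segments no two of which cross, and which has no cycles; its components (trees, including isolated vertices) are its connected components. Rotation by $2\pi/d$ sends each vertex $i$ to $i+n/d$ (mod $n$), and $\Phi$ is invariant if this map sends its edge set to itself. -}

module Defs where

open import Level using (0ℓ)
open import Data.Nat using (ℕ; _+_; _≤_; NonZero)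
open import Data.Nat.DivMod using (_mod_; _/_)
open import Data.Fin using (Fin; toℕ; _<_)
open import Data.List using (List; []; _∷_; _++_; [_]; length)
open import Data.List.Relation.Unary.Linked using (Linked)
open import Data.List.Relation.Unary.Unique.Propositional using (Unique)
open import Data.Product using (Σ; _×_)
open import Data.Empty using (⊥)
open import Relation.Nullary using (¬_)
open import Relation.Binary.PropositionalEquality using (_≡_)
open import Relation.Binary.Construct.Closure.ReflexiveTransitive using (Star)
open import Function.Bundles using (_⇔_)

-- Vertices 1,…,n are modelled as Fin n = {0,…,n-1}, placed clockwise in
-- increasing order on the circle.  A graph is given by its edge relation.
EdgeRel : ℕ → Set₁
EdgeRel n = Fin n → Fin n → Set

IsSimple : ∀ {n} → EdgeRel n → Set
IsSimple {n} E = (∀ (i j : Fin n) → E i j → E j i) × (∀ (i : Fin n) → ¬ E i i)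

-- two straight chords {a,b},{c,d} of the convex n-gon cross iff their
-- endpoints strictly interleave; up to relabelling this is a < c < b < d
NonCrossing : ∀ {n} → EdgeRel n → Set
NonCrossing {n} E = ∀ (a b c d : Fin n) → E a b → E c d → a < c → c < b → b < d → ⊥

-- a cycle: distinct vertices a, w₁, …, wₘ, b (m ≥ 1, so ≥ 3 vertices),
-- consecutive ones adjacent, and b adjacent to a
Cycle : ∀ {n} → EdgeRel n → Set
Cycle {n} E = Σ (Fin n) λ a → Σ (List (Fin n)) λ ws → Σ (Fin n) λ b →
  1 ≤ length ws × Unique (a ∷ ws ++ [ b ]) × Linked E (a ∷ ws ++ [ b ]) × E b a

Acyclic : ∀ {n} → EdgeRel n → Set
Acyclic E = ¬ Cycle E

NonCrossingForest : ∀ {n} → EdgeRel n → Set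
NonCrossingForest E = IsSimple E × NonCrossing E × Acyclic E

Conn : ∀ {n} → EdgeRel n → Fin n → Fin n → Set
Conn E = Star E

-- Φ has exactly k components: the components are in bijection with Fin k
HasComponents : ∀ {n} → EdgeRel n → ℕ → Set
HasComponents {n} E k = Σ (Fin n → Fin k) λ c →
  (∀ (i j : Fin n) → (c i ≡ c j) ⇔ Conn E i j) × (∀ (t : Fin k) → Σ (Fin n) λ i → c i ≡ t)

rot : ∀ n .{{_ : NonZero n}} → ℕ → Fin n → Fin n
rot n s i = (toℕ i + s) mod n

ρ : ∀ n d .{{_ : NonZero n}} .{{_ : NonZero d}} → Fin n → Fin n
ρ n d = rot n (n / d)

Invariant : ∀ n d .{{_ : NonZero n}} .{{_ : NonZero d}} → EdgeRel n → Set
Invariant n d E = ∀ (i j : Fin n) → E i j ⇔ E (ρ n d i) (ρ n d j)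

Tree : ∀ {n} → EdgeRel n → Fin n → Fin n → Set
Tree E v u = Conn E v u

Image : ∀ {n} → (Fin n → Fin n) → (Fin n → Set) → Fin n → Set
Image {n} f S x = Σ (Fin n) λ u → S u × f u ≡ x

_≐_ : ∀ {n} → (Fin n → Set) → (Fin n → Set) → Set
_≐_ {n} S T = ∀ (x : Fin n) → S x ⇔ T x

Disjoint : ∀ {n} → (Fin n → Set) → (Fin n → Set) → Set
Disjoint {n} S T = ∀ (x : Fin n) → S x → T x → ⊥

-- A tree fixed by ρ contains a diameter of the circle.  Acyclicity and non-crossing give a vertex p
-- whose radius meets no edge of the tree (below an innermost long chord, the short chords would close
-- a cycle), and by invariance neither does the radius to ρ p.  A path in the tree from the sector
-- [p, ρ p) to its rotated copy leaves the sector along an edge, which meets one of the two radii unless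
-- it is a diameter.  A diameter crosses its rotation unless d = 2, and diameters of two different
-- trees cross; so for d = 2 the involution induced by ρ on the k components has exactly one fixed
-- point, and k is odd.  The dichotomy for arbitrary trees only uses that ρ is an automorphism.
module Submission where

open import Defs
open import Data.Nat using (ℕ; _≤_; _%_; NonZero)
open import Data.Nat.Divisibility using (_∣_)
open import Data.Fin using (Fin)
open import Data.Product using (Σ; _×_)
open import Data.Sum using (_⊎_)
open import Relation.Binary.PropositionalEquality using (_≡_)

open import Data.Empty using (⊥; ⊥-elim)
open import Data.Fin as Fin using (toℕ; fromℕ<) renaming (_<_ to _<ᶠ_; _≤_ to _≤ᶠ_)
open import Data.Fin.Induction using (>-wellFounded)
open import Data.Fin.Permutation using (permutation)
open import Data.Fin.Properties as Fin using (toℕ<n; toℕ-injective; toℕ-fromℕ<)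
open import Data.List using (List; []; _∷_; _++_; [_])
import Data.List.Relation.Unary.AllPairs as AllPairs
open import Data.List.Relation.Unary.Linked as Linked using (Linked; []; [-]; _∷_)
open import Data.List.Relation.Unary.Linked.Properties using (Linked⇒AllPairs)
open import Data.List.Relation.Unary.Unique.Propositional using (Unique)
open import Data.Nat
open import Data.Nat.DivMod
open import Data.Nat.Divisibility using (∣-refl; ∣⇒≤)
open import Data.Nat.Induction using (<-wellFounded)
open import Data.Nat.Properties
open import Algebra.Properties.CommutativeMonoid.Sum +-0-commutativeMonoid
  using (sum; sum-permute; sum-cong-≗; sum-remove; ∑-distrib-+; sum-replicate-zero)
open import Algebra.Properties.CommutativeSemigroup +-commutativeSemigroup using (interchange)
open import Data.Nat.Tactic.RingSolver using (solve-∀)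
open import Data.Product using (∃; _,_; proj₁; proj₂)
open import Data.Sum using (inj₁; inj₂)
open import Function using (_∘_)
open import Function.Bundles using (_⇔_; Equivalence; mk⇔)
open import Induction.WellFounded using (Acc; acc)
open import Relation.Binary.Construct.Closure.ReflexiveTransitive using (Star; ε; _◅_; _◅◅_; gmap; reverse)
open import Relation.Binary.Definitions using (Tri; tri<; tri≈; tri>)
open import Relation.Binary.PropositionalEquality
  using (_≢_; refl; sym; trans; cong; cong₂; subst; subst₂; module ≡-Reasoning)
open import Relation.Nullary using (¬_; Dec; yes; no; contradiction)
open import Relation.Nullary.Decidable using (_×-dec_; ¬?; map′; decidable-stable; ¬¬-excluded-middle)

m*2≡m+m : ∀ m → m * 2 ≡ m + m
m*2≡m+m = solve-∀

m+m≡n+n⇒m≡n : ∀ {m n} → m + m ≡ n + n → m ≡ n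
m+m≡n+n⇒m≡n {m} {n} eq with <-cmp m n
... | tri< m<n _ _ = contradiction eq (<⇒≢ (+-mono-< m<n m<n))
... | tri≈ _ m≡n _ = m≡n
... | tri> _ _ n<m = contradiction (sym eq) (<⇒≢ (+-mono-< n<m n<m))

maximal : ∀ {m} {P : Fin m → Set} → (∀ x → Dec (P x)) → ∀ {x} → P x →
          Σ (Fin m) λ y → P y × (∀ z → P z → ¬ y <ᶠ z)
maximal {P = P} P? {x} Px = go x Px (>-wellFounded x)
  where
  go : ∀ x → P x → Acc Fin._>_ x → Σ _ λ y → P y × (∀ z → P z → ¬ y <ᶠ z)
  go x Px (acc above) with Fin.any? (λ z → P? z ×-dec x Fin.<? z)
  ... | yes (z , Pz , x<z) = go z Pz (above x<z)
  ... | no none = x , Px , λ z Pz x<z → none (z , Pz , x<z)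

escaping-step : ∀ {A : Set} {R : A → A → Set} (P : A → Set) → (∀ x → Dec (P x)) →
                ∀ {a b} → Star R a b → P a → ¬ P b →
                Σ A λ x → Σ A λ y → Star R a x × R x y × P x × ¬ P y
escaping-step P P? ε Pa ¬Pb = contradiction Pa ¬Pb
escaping-step P P? {a} (_◅_ {j = j} ab rest) Pa ¬Pb with P? j
... | no ¬Pj = a , j , ε , ab , Pa , ¬Pj
... | yes Pj with escaping-step P P? rest Pj ¬Pb
...   | x , y , j↝x , xy , Px , ¬Py = x , y , ab ◅ j↝x , xy , Px , ¬Py

¬¬-∀-Fin : ∀ {m} {P : Fin m → Set} → (∀ x → ¬ ¬ P x) → ¬ ¬ (∀ x → P x)
¬¬-∀-Fin {zero} _ ¬all = ¬all λ ()
¬¬-∀-Fin {suc m} ¬¬P ¬all = ¬¬P Fin.zero λ P0 → ¬¬-∀-Fin (¬¬P ∘ Fin.suc) λ Ps →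
  ¬all λ { Fin.zero → P0 ; (Fin.suc x) → Ps x }

¬¬-Decidable-Fin : ∀ {m} (R : Fin m → Fin m → Set) → ¬ ¬ (∀ i j → Dec (R i j))
¬¬-Decidable-Fin R = ¬¬-∀-Fin λ i → ¬¬-∀-Fin λ j → ¬¬-excluded-middle

components⇒Conn? : ∀ {n k} {E : EdgeRel n} → HasComponents E k → ∀ i j → Dec (Conn E i j)
components⇒Conn? (c , c-conn , _) i j =
  map′ (Equivalence.to (c-conn i j)) (Equivalence.from (c-conn i j)) (c i Fin.≟ c j)

module Clockwise (n : ℕ) .{{_ : NonZero n}} where

  infix 4 _≈_
  _≈_ : ℕ → ℕ → Set
  a ≈ b = a % n ≡ b % n

  ≈-+ : ∀ {a b c d} → a ≈ b → c ≈ d → a + c ≈ b + d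
  ≈-+ {a} {b} {c} {d} a≈b c≈d = begin
    (a + c) % n          ≡⟨ %-distribˡ-+ a c n ⟩
    (a % n + c % n) % n  ≡⟨ cong₂ (λ u v → (u + v) % n) a≈b c≈d ⟩
    (b % n + d % n) % n  ≡⟨ %-distribˡ-+ b d n ⟨
    (b + d) % n          ∎
    where open ≡-Reasoning

  ≈-+ˡ : ∀ a {b c} → b ≈ c → a + b ≈ a + c
  ≈-+ˡ a = ≈-+ {a} {a} refl

  %-≈ : ∀ a → a % n ≈ a
  %-≈ a = m%n%n≡m%n a n

  n+-≈ : ∀ a → n + a ≈ a
  n+-≈ a = %-remove-+ˡ a ∣-refl

  ≈-cancelˡ : ∀ a {b c} → a + b ≈ a + c → b ≈ c
  ≈-cancelˡ a {b} {c} a+b≈a+c = trans (sym (undo b)) (trans (≈-+ˡ m a+b≈a+c) (undo c))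
    where
    m = n ∸ a % n
    undo : ∀ x → m + (a + x) ≈ x
    undo x = begin
      (m + (a + x)) % n        ≡⟨ ≈-+ˡ m (≈-+ {a} {a % n} {x} (sym (%-≈ a)) refl) ⟩
      (m + (a % n + x)) % n    ≡⟨ cong (_% n) (+-assoc m (a % n) x) ⟨
      (m + a % n + x) % n      ≡⟨ cong (λ u → (u + x) % n) (m∸n+n≡m (m%n≤n a n)) ⟩
      (n + x) % n              ≡⟨ n+-≈ x ⟩
      x % n                    ∎
      where open ≡-Reasoning

  ≈⇒≡ : ∀ {a b} → a < n → b < n → a ≈ b → a ≡ b
  ≈⇒≡ a<n b<n a≈b = trans (sym (m<n⇒m%n≡m a<n)) (trans a≈b (m<n⇒m%n≡m b<n))

  toℕ-≈-injective : ∀ {x y : Fin n} → toℕ x ≈ toℕ y → x ≡ y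
  toℕ-≈-injective = toℕ-injective ∘ ≈⇒≡ (toℕ<n _) (toℕ<n _)

  cw : Fin n → Fin n → ℕ
  cw x y = (toℕ y + (n ∸ toℕ x)) % n

  cw<n : ∀ x y → cw x y < n
  cw<n x y = m%n<n _ n

  cw-spec : ∀ x y → toℕ x + cw x y ≈ toℕ y
  cw-spec x y = begin
    (toℕ x + cw x y) % n               ≡⟨ ≈-+ˡ (toℕ x) (%-≈ (toℕ y + (n ∸ toℕ x))) ⟩
    (toℕ x + (toℕ y + (n ∸ toℕ x))) % n ≡⟨ cong (_% n) (a+[b+[n∸a]]≡n+b (toℕ y) (<⇒≤ (toℕ<n x))) ⟩
    (n + toℕ y) % n                     ≡⟨ n+-≈ (toℕ y) ⟩
    toℕ y % n                           ∎
    where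
    open ≡-Reasoning
    a+[b+[n∸a]]≡n+b : ∀ {a} b → a ≤ n → a + (b + (n ∸ a)) ≡ n + b
    a+[b+[n∸a]]≡n+b {a} b a≤n = begin
      a + (b + (n ∸ a)) ≡⟨ cong (a +_) (+-comm b (n ∸ a)) ⟩
      a + ((n ∸ a) + b) ≡⟨ +-assoc a (n ∸ a) b ⟨
      a + (n ∸ a) + b   ≡⟨ cong (_+ b) (m+[n∸m]≡n a≤n) ⟩
      n + b             ∎

  cw-unique : ∀ {x y c} → c < n → toℕ x + c ≈ toℕ y → c ≡ cw x y
  cw-unique {x} {y} c<n x+c≈y =
    ≈⇒≡ c<n (cw<n x y) (≈-cancelˡ (toℕ x) (trans x+c≈y (sym (cw-spec x y))))

  cw-injective : ∀ x {y z} → cw x y ≡ cw x z → y ≡ z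
  cw-injective x {y} {z} eq =
    toℕ-≈-injective (trans (sym (cw-spec x y)) (trans (cong (λ c → (toℕ x + c) % n) eq) (cw-spec x z)))

  cw-self : ∀ x → cw x x ≡ 0
  cw-self x = sym (cw-unique (>-nonZero⁻¹ n) (cong (_% n) (+-identityʳ (toℕ x))))

  cw-pos : ∀ {x y} → x ≢ y → 0 < cw x y
  cw-pos {x} {y} x≢y = n≢0⇒n>0 (λ cw≡0 → x≢y (cw-injective x (trans (cw-self x) (sym cw≡0))))

  cw-≤ : ∀ {x y} → toℕ x ≤ toℕ y → toℕ x + cw x y ≡ toℕ y
  cw-≤ {x} {y} x≤y = begin
    toℕ x + cw x y           ≡⟨ cong (toℕ x +_) (cw-unique (≤-<-trans (m∸n≤m (toℕ y) (toℕ x)) (toℕ<n y))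
                                                    (cong (_% n) (m+[n∸m]≡n x≤y))) ⟨
    toℕ x + (toℕ y ∸ toℕ x) ≡⟨ m+[n∸m]≡n x≤y ⟩
    toℕ y                    ∎
    where open ≡-Reasoning

  cw-> : ∀ {x y} → toℕ y < toℕ x → toℕ x + cw x y ≡ n + toℕ y
  cw-> {x} {y} y<x = begin
    toℕ x + cw x y                ≡⟨ cong (toℕ x +_) c≡cw ⟨
    toℕ x + (n + toℕ y ∸ toℕ x)  ≡⟨ x+c≡n+y ⟩
    n + toℕ y                     ∎
    where
    open ≡-Reasoning
    x≤n+y : toℕ x ≤ n + toℕ y
    x≤n+y = ≤-trans (<⇒≤ (toℕ<n x)) (m≤m+n n (toℕ y))
    x+c≡n+y : toℕ x + (n + toℕ y ∸ toℕ x) ≡ n + toℕ y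
    x+c≡n+y = m+[n∸m]≡n x≤n+y
    c<n : n + toℕ y ∸ toℕ x < n
    c<n = +-cancelˡ-< (toℕ x) _ n (subst (_< toℕ x + n) (sym x+c≡n+y)
            (subst (n + toℕ y <_) (+-comm n (toℕ x)) (+-monoʳ-< n y<x)))
    c≡cw : n + toℕ y ∸ toℕ x ≡ cw x y
    c≡cw = cw-unique c<n (trans (cong (_% n) x+c≡n+y) (n+-≈ (toℕ y)))

  ≈-split : ∀ {a b} → a < n + n → b < n → a ≈ b → a ≡ b ⊎ a ≡ b + n
  ≈-split {a} {b} a<2n b<n a≈b with a <? n
  ... | yes a<n = inj₁ (≈⇒≡ a<n b<n a≈b)
  ... | no a≮n = inj₂ (trans (sym (m∸n+n≡m n≤a)) (cong (_+ n) a∸n≡b))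
    where
    n≤a = ≮⇒≥ a≮n
    a∸n≡b : a ∸ n ≡ b
    a∸n≡b = ≈⇒≡ (+-cancelʳ-< n (a ∸ n) n (subst (_< n + n) (sym (m∸n+n≡m n≤a)) a<2n)) b<n
                (trans (m≤n⇒[n∸m]%m≡n%m n≤a) a≈b)

  cw-cocycle : ∀ x y z → cw x y + cw y z ≡ cw x z ⊎ cw x y + cw y z ≡ cw x z + n
  cw-cocycle x y z = ≈-split (+-mono-< (cw<n x y) (cw<n y z)) (cw<n x z) (≈-cancelˡ (toℕ x) (begin
    (toℕ x + (cw x y + cw y z)) % n  ≡⟨ cong (_% n) (+-assoc (toℕ x) (cw x y) (cw y z)) ⟨
    (toℕ x + cw x y + cw y z) % n    ≡⟨ ≈-+ (cw-spec x y) refl ⟩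
    (toℕ y + cw y z) % n             ≡⟨ trans (cw-spec y z) (sym (cw-spec x z)) ⟩
    (toℕ x + cw x z) % n             ∎))
    where open ≡-Reasoning

  cw-+ : ∀ x y z → cw x y ≤ cw x z → cw x y + cw y z ≡ cw x z
  cw-+ x y z xy≤xz with cw-cocycle x y z
  ... | inj₁ eq = eq
  ... | inj₂ eq = contradiction (subst (_< cw x z + n) eq (+-mono-≤-< xy≤xz (cw<n y z))) (<-irrefl refl)

  cw-flip : ∀ {x y} → x ≢ y → cw x y + cw y x ≡ n
  cw-flip {x} {y} x≢y with cw-cocycle x y x
  ... | inj₂ eq = trans eq (cong (_+ n) (cw-self x))
  ... | inj₁ eq = contradiction (m+n≡0⇒m≡0 (cw x y) (trans eq (cw-self x))) (n>0⇒n≢0 (cw-pos x≢y))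

  cw-+-small : ∀ x y z → cw x y + cw y z < n → cw x y + cw y z ≡ cw x z
  cw-+-small x y z sum<n with cw-cocycle x y z
  ... | inj₁ eq = eq
  ... | inj₂ eq = contradiction (subst (_< n) eq sum<n) (m+n≮n (cw x z) n)

  cw-+-large : ∀ x y z → n ≤ cw x y + cw y z → cw x y + cw y z ≡ cw x z + n
  cw-+-large x y z n≤sum with cw-cocycle x y z
  ... | inj₂ eq = eq
  ... | inj₁ eq = contradiction (subst (n ≤_) eq n≤sum) (<⇒≱ (cw<n x z))

  cw-+ʳ : ∀ x y z → cw y z ≤ cw x z → cw x y + cw y z ≡ cw x z
  cw-+ʳ x y z yz≤xz with cw-cocycle x y z
  ... | inj₁ eq = eq
  ... | inj₂ eq = contradiction (subst (_< n + cw x z) eq (+-mono-<-≤ (cw<n x y) yz≤xz))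
                                (<-irrefl (+-comm (cw x z) n))

  Short Long Diameter : Fin n → Fin n → Set
  Short x y = cw x y + cw x y < n
  Long x y = n < cw x y + cw x y
  Diameter x y = cw x y + cw x y ≡ n

  cw-flip-twice : ∀ {x y} → x ≢ y → (cw x y + cw x y) + (cw y x + cw y x) ≡ n + n
  cw-flip-twice {x} {y} x≢y = trans (interchange (cw x y) (cw x y) (cw y x) (cw y x))
                                    (cong₂ _+_ (cw-flip x≢y) (cw-flip x≢y))

  long⇒flip-short : ∀ {x y} → Long x y → Short y x
  long⇒flip-short {x} {y} long = +-cancelˡ-< (cw x y + cw x y) _ _
    (subst (_< cw x y + cw x y + n) (sym (cw-flip-twice x≢y)) (+-monoˡ-< n long))
    where
    x≢y : x ≢ y
    x≢y refl = contradiction (subst (λ c → n < c + c) (cw-self x) long) (λ ())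

  short⇒flip-long : ∀ {x y} → x ≢ y → Short x y → Long y x
  short⇒flip-long {x} {y} x≢y short = +-cancelˡ-< (cw x y + cw x y) _ _
    (subst (cw x y + cw x y + n <_) (sym (cw-flip-twice x≢y)) (+-monoˡ-< n short))

  short-or-short : ∀ {x y} → x ≢ y → ¬ Diameter x y → Short x y ⊎ Short y x
  short-or-short {x} {y} x≢y ¬diam with <-cmp (cw x y + cw x y) n
  ... | tri< short _ _ = inj₁ short
  ... | tri≈ _ diam _ = contradiction diam ¬diam
  ... | tri> _ _ long = inj₂ (long⇒flip-short {x} {y} long)

  cw-pos⇒< : ∀ {a z} → toℕ a ≤ toℕ z → 0 < cw a z → toℕ a < toℕ z
  cw-pos⇒< {a} {z} a≤z pos = subst (toℕ a <_) (cw-≤ a≤z) (m<m+n (toℕ a) pos)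

  cw-<⇒<-above : ∀ {a z z'} → toℕ a ≤ toℕ z → toℕ a ≤ toℕ z' → cw a z < cw a z' → toℕ z < toℕ z'
  cw-<⇒<-above {a} a≤z a≤z' lt = subst₂ _<_ (cw-≤ a≤z) (cw-≤ a≤z') (+-monoʳ-< (toℕ a) lt)

  cw-<⇒<-below : ∀ {a z z'} → toℕ z < toℕ a → toℕ z' < toℕ a → cw a z < cw a z' → toℕ z < toℕ z'
  cw-<⇒<-below {a} z<a z'<a lt = +-cancelˡ-< n _ _ (subst₂ _<_ (cw-> z<a) (cw-> z'<a) (+-monoʳ-< (toℕ a) lt))

  -- Measured clockwise from a, the vertices ≥ a come before the vertices < a.
  cw-<-below : ∀ {a z z'} → toℕ z < toℕ a → cw a z < cw a z' → toℕ z' < toℕ a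
  cw-<-below {a} {z} {z'} z<a lt with toℕ z' <? toℕ a
  ... | yes z'<a = z'<a
  ... | no z'≮a = contradiction (+-monoʳ-< (toℕ a) lt) (<-asym (begin-strict
    toℕ a + cw a z' ≡⟨ cw-≤ (≮⇒≥ z'≮a) ⟩
    toℕ z'          <⟨ toℕ<n z' ⟩
    n               ≤⟨ m≤m+n n (toℕ z) ⟩
    n + toℕ z       ≡⟨ cw-> z<a ⟨
    toℕ a + cw a z  ∎))
    where open ≤-Reasoning

  module _ {E : EdgeRel n} (E-sym : ∀ i j → E i j → E j i) (E-nc : NonCrossing E) where

    -- Some rotation of the cyclic sequence a, c, b, e is increasing, which NonCrossing rules out.
    cw-noncrossing : ∀ {a b c e} → E a b → E c e → 0 < cw a c → cw a c < cw a b → cw a b < cw a e → ⊥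
    cw-noncrossing {a} {b} {c} {e} ab ce 0<ac ac<ab ab<ae
      with toℕ a ≤? toℕ c | toℕ a ≤? toℕ b | toℕ a ≤? toℕ e
    ... | yes a≤c | yes a≤b | yes a≤e =
      E-nc a b c e ab ce (cw-pos⇒< a≤c 0<ac) (cw-<⇒<-above a≤c a≤b ac<ab) (cw-<⇒<-above a≤b a≤e ab<ae)
    ... | yes a≤c | yes a≤b | no a≰e =
      E-nc e c a b (E-sym c e ce) ab (≰⇒> a≰e) (cw-pos⇒< a≤c 0<ac) (cw-<⇒<-above a≤c a≤b ac<ab)
    ... | _ | no a≰b | yes a≤e = contradiction (cw-<-below (≰⇒> a≰b) ab<ae) (≤⇒≯ a≤e)
    ... | yes a≤c | no a≰b | no a≰e =
      E-nc b a e c (E-sym a b ab) (E-sym c e ce) (cw-<⇒<-below (≰⇒> a≰b) (≰⇒> a≰e) ab<ae) (≰⇒> a≰e)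
           (cw-pos⇒< a≤c 0<ac)
    ... | no a≰c | yes a≤b | _ = contradiction (cw-<-below (≰⇒> a≰c) ac<ab) (≤⇒≯ a≤b)
    ... | no a≰c | no a≰b | no a≰e =
      E-nc c e b a ce (E-sym a b ab) (cw-<⇒<-below (≰⇒> a≰c) (≰⇒> a≰b) ac<ab)
           (cw-<⇒<-below (≰⇒> a≰b) (≰⇒> a≰e) ab<ae) (≰⇒> a≰e)

    -- y and its antipode y' lie on opposite sides of the diameter x x'.
    diameters-cross : ∀ {x x' y y'} → E x x' → Diameter x x' → E y y' → Diameter y y' →
                      x ≢ y → x' ≢ y → ⊥
    diameters-cross {x} {x'} {y} {y'} xx' xx'-diam yy' yy'-diam x≢y x'≢y = by-position (<-cmp (cw x y) h)
      where
      h = cw x x'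
      yy'≡h : cw y y' ≡ h
      yy'≡h = m+m≡n+n⇒m≡n (trans yy'-diam (sym xx'-diam))
      by-position : Tri (cw x y < h) (cw x y ≡ h) (h < cw x y) → ⊥
      by-position (tri≈ _ xy≡h _) = x'≢y (cw-injective x (sym xy≡h))
      by-position (tri< xy<h _ _) =
        cw-noncrossing xx' yy' (cw-pos x≢y) xy<h (subst (h <_) xy+h≡xy' (m<n+m h (cw-pos x≢y)))
        where
        xy+h<n : cw x y + cw y y' < n
        xy+h<n = subst₂ (λ c m → cw x y + c < m) (sym yy'≡h) xx'-diam (+-monoˡ-< h xy<h)
        xy+h≡xy' : cw x y + h ≡ cw x y'
        xy+h≡xy' = trans (cong (cw x y +_) (sym yy'≡h)) (cw-+-small x y y' xy+h<n)
      by-position (tri> _ _ h<xy) = cw-noncrossing xx' (E-sym y y' yy') 0<xy' xy'<h h<xy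
        where
        n≤xy+h : n ≤ cw x y + cw y y'
        n≤xy+h = subst₂ (λ m c → m ≤ cw x y + c) xx'-diam (sym yy'≡h) (+-monoˡ-≤ h (<⇒≤ h<xy))
        xy'+h≡xy : cw x y' + h ≡ cw x y
        xy'+h≡xy = +-cancelʳ-≡ h (cw x y' + h) (cw x y) (begin
          cw x y' + h + h   ≡⟨ +-assoc (cw x y') h h ⟩
          cw x y' + (h + h) ≡⟨ cong (cw x y' +_) xx'-diam ⟩
          cw x y' + n       ≡⟨ cw-+-large x y y' n≤xy+h ⟨
          cw x y + cw y y'  ≡⟨ cong (cw x y +_) yy'≡h ⟩
          cw x y + h        ∎)
          where open ≡-Reasoning
        0<xy' : 0 < cw x y'
        0<xy' = +-cancelʳ-< h 0 (cw x y') (subst (h <_) (sym xy'+h≡xy) h<xy)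
        xy'<h : cw x y' < h
        xy'<h = +-cancelʳ-< h (cw x y') h (subst₂ _<_ (sym xy'+h≡xy) (sym xx'-diam) (cw<n x y))

  rot-≈ : ∀ t x → toℕ (rot n t x) ≈ toℕ x + t
  rot-≈ t x = trans (cong (_% n) (toℕ-fromℕ< (m%n<n (toℕ x + t) n))) (%-≈ (toℕ x + t))

  rot-inverse : ∀ {t t'} → t' + t ≡ n → ∀ x → rot n t (rot n t' x) ≡ x
  rot-inverse {t} {t'} t'+t≡n x = toℕ-≈-injective (begin
    toℕ (rot n t (rot n t' x)) % n  ≡⟨ rot-≈ t (rot n t' x) ⟩
    (toℕ (rot n t' x) + t) % n      ≡⟨ ≈-+ (rot-≈ t' x) refl ⟩
    (toℕ x + t' + t) % n            ≡⟨ cong (_% n) (trans (+-assoc (toℕ x) t' t) (+-comm (toℕ x) (t' + t))) ⟩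
    (t' + t + toℕ x) % n            ≡⟨ cong (λ m → (m + toℕ x) % n) t'+t≡n ⟩
    (n + toℕ x) % n                 ≡⟨ n+-≈ (toℕ x) ⟩
    toℕ x % n                       ∎)
    where open ≡-Reasoning

  cw-rot : ∀ t x y → cw (rot n t x) (rot n t y) ≡ cw x y
  cw-rot t x y = sym (cw-unique (cw<n x y) (begin
    (toℕ (rot n t x) + cw x y) % n  ≡⟨ ≈-+ (rot-≈ t x) refl ⟩
    (toℕ x + t + cw x y) % n        ≡⟨ cong (_% n) (x+t+c≡x+c+t (toℕ x) t (cw x y)) ⟩
    (toℕ x + cw x y + t) % n        ≡⟨ ≈-+ (cw-spec x y) refl ⟩
    (toℕ y + t) % n                 ≡⟨ rot-≈ t y ⟨
    toℕ (rot n t y) % n             ∎))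
    where
    open ≡-Reasoning
    x+t+c≡x+c+t : ∀ a b c → a + b + c ≡ a + c + b
    x+t+c≡x+c+t = solve-∀

  cw-rot-self : ∀ {t} → t < n → ∀ x → cw x (rot n t x) ≡ t
  cw-rot-self t<n x = sym (cw-unique t<n (sym (rot-≈ _ x)))

  cw-inside : ∀ {x y p} → toℕ x ≤ toℕ y → 0 < cw x p → cw x p ≤ cw x y →
              toℕ x < toℕ p × toℕ p ≤ toℕ y
  cw-inside {x} {y} {p} x≤y 0<xp xp≤xy with toℕ x ≤? toℕ p
  ... | yes x≤p = subst (toℕ x <_) (cw-≤ x≤p) (m<m+n (toℕ x) 0<xp)
                , subst₂ _≤_ (cw-≤ x≤p) (cw-≤ x≤y) (+-monoʳ-≤ (toℕ x) xp≤xy)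
  ... | no x≰p = contradiction (+-monoʳ-≤ (toℕ x) xp≤xy) (<⇒≱ (begin-strict
    toℕ x + cw x y  ≡⟨ cw-≤ x≤y ⟩
    toℕ y           <⟨ toℕ<n y ⟩
    n               ≤⟨ m≤m+n n (toℕ p) ⟩
    n + toℕ p       ≡⟨ cw-> (≰⇒> x≰p) ⟨
    toℕ x + cw x p  ∎))
    where open ≤-Reasoning

  cw-inside-wrap : ∀ {x y p} → toℕ y < toℕ x → 0 < cw x p → cw x p ≤ cw x y →
                   toℕ p ≤ toℕ y ⊎ toℕ x < toℕ p
  cw-inside-wrap {x} {y} {p} y<x 0<xp xp≤xy with toℕ p ≤? toℕ y | <-cmp (toℕ x) (toℕ p)
  ... | yes p≤y | _ = inj₁ p≤y
  ... | no _ | tri< x<p _ _ = inj₂ x<p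
  ... | no _ | tri≈ _ x≡p _ =
    contradiction (trans (cong (cw x) (toℕ-injective (sym x≡p))) (cw-self x)) (n>0⇒n≢0 0<xp)
  ... | no p≰y | tri> _ _ p<x = contradiction (+-monoʳ-≤ (toℕ x) xp≤xy) (<⇒≱ (begin-strict
    toℕ x + cw x y  ≡⟨ cw-> y<x ⟩
    n + toℕ y       <⟨ +-monoʳ-< n (≰⇒> p≰y) ⟩
    n + toℕ p       ≡⟨ cw-> p<x ⟨
    toℕ x + cw x p  ∎))
    where open ≤-Reasoning

  cw-nested : ∀ {a b x y} → toℕ a ≤ toℕ x → toℕ x ≤ toℕ y → toℕ y ≤ toℕ b → cw x y ≤ cw a b
  cw-nested {a} {b} {x} {y} a≤x x≤y y≤b = +-cancelˡ-≤ (toℕ x) _ _ (begin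
    toℕ x + cw x y  ≡⟨ cw-≤ x≤y ⟩
    toℕ y           ≤⟨ y≤b ⟩
    toℕ b           ≡⟨ cw-≤ (≤-trans a≤x (≤-trans x≤y y≤b)) ⟨
    toℕ a + cw a b  ≤⟨ +-monoˡ-≤ (cw a b) a≤x ⟩
    toℕ x + cw a b  ∎)
    where open ≤-Reasoning

  cw-nested-< : ∀ {a b x y} → toℕ a ≤ toℕ x → toℕ x ≤ toℕ y → toℕ y ≤ toℕ b →
                toℕ a < toℕ x ⊎ toℕ y < toℕ b → cw x y < cw a b
  cw-nested-< {a} {b} {x} {y} a≤x x≤y y≤b a<x⊎y<b = +-cancelˡ-< (toℕ x) _ _ (strictly a<x⊎y<b)
    where
    open ≤-Reasoning
    a≤b = ≤-trans a≤x (≤-trans x≤y y≤b)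
    strictly : toℕ a < toℕ x ⊎ toℕ y < toℕ b → toℕ x + cw x y < toℕ x + cw a b
    strictly (inj₁ a<x) = begin-strict
      toℕ x + cw x y  ≡⟨ cw-≤ x≤y ⟩
      toℕ y           ≤⟨ y≤b ⟩
      toℕ b           ≡⟨ cw-≤ a≤b ⟨
      toℕ a + cw a b  <⟨ +-monoˡ-< (cw a b) a<x ⟩
      toℕ x + cw a b  ∎
    strictly (inj₂ y<b) = begin-strict
      toℕ x + cw x y  ≡⟨ cw-≤ x≤y ⟩
      toℕ y           <⟨ y<b ⟩
      toℕ b           ≡⟨ cw-≤ a≤b ⟨
      toℕ a + cw a b  ≤⟨ +-monoˡ-≤ (cw a b) a≤x ⟩
      toℕ x + cw a b  ∎

  cw-disjoint : ∀ {a b x y} → toℕ a ≤ toℕ b → toℕ b ≤ toℕ x → toℕ x ≤ toℕ y →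
                cw a b + cw x y < n
  cw-disjoint {a} {b} {x} {y} a≤b b≤x x≤y = begin-strict
    cw a b + cw x y          ≤⟨ +-monoˡ-≤ (cw x y) (m≤n+m (cw a b) (toℕ a)) ⟩
    toℕ a + cw a b + cw x y  ≡⟨ cong (_+ cw x y) (cw-≤ a≤b) ⟩
    toℕ b + cw x y           ≤⟨ +-monoˡ-≤ (cw x y) b≤x ⟩
    toℕ x + cw x y           ≡⟨ cw-≤ x≤y ⟩
    toℕ y                    <⟨ toℕ<n y ⟩
    n                        ∎
    where open ≤-Reasoning

  long-disjoint : ∀ {a b x y} → toℕ a ≤ toℕ b → toℕ b ≤ toℕ x → toℕ x ≤ toℕ y →
                  Long a b → Long x y → ⊥
  long-disjoint {a} {b} {x} {y} a≤b b≤x x≤y ab-long xy-long = <-asym (+-mono-< ab-long xy-long) (begin-strict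
    (cw a b + cw a b) + (cw x y + cw x y)  ≡⟨ interchange (cw a b) (cw a b) (cw x y) (cw x y) ⟩
    (cw a b + cw x y) + (cw a b + cw x y)  <⟨ +-mono-< disjoint disjoint ⟩
    n + n                                  ∎)
    where
    open ≤-Reasoning
    disjoint = cw-disjoint a≤b b≤x x≤y

  cw-between : ∀ {p x q y} → cw p x < cw p q → cw p q ≤ cw p y → 0 < cw x q × cw x q ≤ cw x y
  cw-between {p} {x} {q} {y} px<pq pq≤py =
    +-cancelˡ-< (cw p x) 0 (cw x q) (subst₂ _<_ (sym (+-identityʳ (cw p x))) (sym px+xq≡pq) px<pq) ,
    +-cancelˡ-≤ (cw p x) _ _
      (subst₂ _≤_ (sym px+xq≡pq) (sym (cw-+ p x y (<⇒≤ (<-≤-trans px<pq pq≤py)))) pq≤py)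
    where
    px+xq≡pq : cw p x + cw x q ≡ cw p q
    px+xq≡pq = cw-+ p x q (<⇒≤ px<pq)

  cw-between-flip : ∀ {p x y} → cw p x < cw p y → 0 < cw y p × cw y p ≤ cw y x
  cw-between-flip {p} {x} {y} px<py = cw-pos y≢p , +-cancelʳ-≤ (cw x y) _ _ (begin
    cw y p + cw x y  ≤⟨ +-monoʳ-≤ (cw y p) xy≤py ⟩
    cw y p + cw p y  ≡⟨ trans (+-comm (cw y p) (cw p y)) (cw-flip p≢y) ⟩
    n                ≡⟨ trans (+-comm (cw y x) (cw x y)) (cw-flip x≢y) ⟨
    cw y x + cw x y  ∎)
    where
    open ≤-Reasoning
    px+xy≡py : cw p x + cw x y ≡ cw p y
    px+xy≡py = cw-+ p x y (<⇒≤ px<py)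
    xy≤py : cw x y ≤ cw p y
    xy≤py = subst (cw x y ≤_) px+xy≡py (m≤n+m (cw x y) (cw p x))
    y≢p : y ≢ p
    y≢p refl = n≮0 (subst (cw p x <_) (cw-self p) px<py)
    p≢y : p ≢ y
    p≢y = y≢p ∘ sym
    x≢y : x ≢ y
    x≢y refl = <-irrefl refl px<py

module FreeRadius (n : ℕ) .{{_ : NonZero n}} (F : EdgeRel n) (F-sym : ∀ i j → F i j → F j i)
                  (F-nc : NonCrossing F) (F-acyclic : Acyclic F) (F? : ∀ i j → Dec (F i j)) where

  open Clockwise n

  -- The radius from the centre to p meets the chord x y, whose shorter arc (x, y] contains p.
  Covers : Fin n → Fin n → Fin n → Set
  Covers x y p = F x y × Short x y × 0 < cw x p × cw x p ≤ cw x y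

  Covers? : ∀ x y p → Dec (Covers x y p)
  Covers? x y p = F? x y ×-dec _ <? n ×-dec 0 <? _ ×-dec _ ≤? _

  covers⇒≢ : ∀ {x y p} → Covers x y p → x ≢ y
  covers⇒≢ {x} (_ , _ , 0<xp , xp≤xx) refl = <⇒≱ 0<xp (subst (cw x _ ≤_) (cw-self x) xp≤xx)

  laminar : ∀ {a b x y} → F a b → F x y →
            b ≤ᶠ x ⊎ y ≤ᶠ a ⊎ (a ≤ᶠ x × y ≤ᶠ b) ⊎ (x ≤ᶠ a × b ≤ᶠ y)
  laminar {a} {b} {x} {y} ab xy with <-cmp (toℕ x) (toℕ a)
  ... | tri≈ _ x≡a _ with toℕ y ≤? toℕ b
  ...   | yes y≤b = inj₂ (inj₂ (inj₁ (≤-reflexive (sym x≡a) , y≤b)))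
  ...   | no y≰b = inj₂ (inj₂ (inj₂ (≤-reflexive x≡a , <⇒≤ (≰⇒> y≰b))))
  laminar {a} {b} {x} {y} ab xy | tri< x<a _ _ with toℕ y ≤? toℕ a | toℕ b ≤? toℕ y
  ...   | yes y≤a | _ = inj₂ (inj₁ y≤a)
  ...   | no _ | yes b≤y = inj₂ (inj₂ (inj₂ (<⇒≤ x<a , b≤y)))
  ...   | no y≰a | no b≰y = ⊥-elim (F-nc x y a b xy ab x<a (≰⇒> y≰a) (≰⇒> b≰y))
  laminar {a} {b} {x} {y} ab xy | tri> _ _ a<x with toℕ b ≤? toℕ x | toℕ y ≤? toℕ b
  ...   | yes b≤x | _ = inj₁ b≤x
  ...   | no _ | yes y≤b = inj₂ (inj₂ (inj₁ (<⇒≤ a<x , y≤b)))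
  ...   | no b≰x | no y≰b = ⊥-elim (F-nc a b x y ab xy a<x (≰⇒> b≰x) (≰⇒> y≰b))

  ShortEdge : EdgeRel n
  ShortEdge x y = F x y × Short x y

  CoveredWithin : Fin n → Fin n → Fin n → Set
  CoveredWithin a b p = Σ (Fin n) λ x → Σ (Fin n) λ y →
    ShortEdge x y × a ≤ᶠ x × x <ᶠ p × p ≤ᶠ y × y ≤ᶠ b

  IncreasingPath : Fin n → Fin n → Set
  IncreasingPath a b = Σ (List (Fin n)) λ ws →
    Linked ShortEdge (a ∷ ws ++ [ b ]) × Linked _<ᶠ_ (a ∷ ws ++ [ b ])

  increasing-path : ∀ {a b} → a <ᶠ b → (∀ p → a <ᶠ p → p ≤ᶠ b → CoveredWithin a b p) →
                    IncreasingPath a b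
  increasing-path {a} {b} = go a (>-wellFounded a)
    where
    go : ∀ a → Acc Fin._>_ a → a <ᶠ b → (∀ p → a <ᶠ p → p ≤ᶠ b → CoveredWithin a b p) →
         IncreasingPath a b
    go a (acc above) a<b covered =
      extend (maximal Reach? (proj₂ (first-step (covered a+1 a<a+1 a+1≤b))))
      where
      Reach : Fin n → Set
      Reach y = ShortEdge a y × a <ᶠ y × y ≤ᶠ b
      Reach? : ∀ y → Dec (Reach y)
      Reach? y = (F? a y ×-dec _ <? n) ×-dec _ <? _ ×-dec _ ≤? _

      a+1 : Fin n
      a+1 = fromℕ< (≤-<-trans a<b (toℕ<n b))
      a<a+1 : a <ᶠ a+1
      a<a+1 = ≤-reflexive (sym (toℕ-fromℕ< _))
      a+1≤b : a+1 ≤ᶠ b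
      a+1≤b = subst (_≤ toℕ b) (sym (toℕ-fromℕ< _)) a<b

      first-step : CoveredWithin a b a+1 → ∃ Reach
      first-step (x , y , xy , a≤x , x<a+1 , a+1≤y , y≤b) =
        y , subst (λ x → ShortEdge x y) x≡a xy , a<y , y≤b
        where
        x≡a : x ≡ a
        x≡a = toℕ-injective (≤-antisym (≤-pred (subst (toℕ x <_) (toℕ-fromℕ< _) x<a+1)) a≤x)
        a<y : a <ᶠ y
        a<y = subst (_≤ toℕ y) (toℕ-fromℕ< _) a+1≤y

      extend : Σ (Fin n) (λ y → Reach y × (∀ z → Reach z → ¬ y <ᶠ z)) → IncreasingPath a b
      extend (y , (ay , a<y , y≤b) , furthest) with y Fin.≟ b
      ... | yes refl = [] , ay ∷ [-] , a<y ∷ [-]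
      ... | no y≢b = prepend (go y (above a<y) (≤∧≢⇒< y≤b (y≢b ∘ toℕ-injective)) covered')
        where
        prepend : IncreasingPath y b → IncreasingPath a b
        prepend (ws , edges , increasing) = y ∷ ws , ay ∷ edges , a<y ∷ increasing
        -- A cover starting left of y starts at a, against the choice of y, or crosses the edge a y.
        covered' : ∀ p → y <ᶠ p → p ≤ᶠ b → CoveredWithin y b p
        covered' p y<p p≤b with covered p (<-trans a<y y<p) p≤b
        ... | x , z , xz , a≤x , x<p , p≤z , z≤b with toℕ y ≤? toℕ x | toℕ a <? toℕ x
        ...   | yes y≤x | _ = x , z , xz , y≤x , x<p , p≤z , z≤b
        ...   | no y≰x | yes a<x =
          ⊥-elim (F-nc a y x z (proj₁ ay) (proj₁ xz) a<x (≰⇒> y≰x) (<-≤-trans y<p p≤z))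
        ...   | no _ | no a≮x =
          ⊥-elim (furthest z (subst (λ x → ShortEdge x z) x≡a xz , <-≤-trans (<-trans a<y y<p) p≤z , z≤b)
                           (<-≤-trans y<p p≤z))
          where
          x≡a : x ≡ a
          x≡a = toℕ-injective (≤-antisym (≮⇒≥ a≮x) a≤x)

  long-chord-path⇒⊥ : ∀ {a b} → F a b → Long a b → IncreasingPath a b → ⊥
  long-chord-path⇒⊥ _ long ([] , (ab ∷ [-]) , _) = <-asym (proj₂ ab) long
  long-chord-path⇒⊥ {a} {b} ab _ (w ∷ ws , edges , increasing) =
    F-acyclic (a , w ∷ ws , b , s≤s z≤n , distinct , Linked.map proj₁ edges , F-sym a b ab)
    where
    distinct : Unique (a ∷ w ∷ ws ++ [ b ])
    distinct = AllPairs.map Fin.<⇒≢ (Linked⇒AllPairs Fin.<-trans increasing)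

  LongChord : Fin n → Fin n → Set
  LongChord a b = F a b × a <ᶠ b × Long a b

  InnerLongChord : Fin n → Fin n → Fin n → Fin n → Set
  InnerLongChord a b x y = LongChord x y × a ≤ᶠ x × y ≤ᶠ b × cw x y < cw a b

  InnerLongChord? : ∀ a b x y → Dec (InnerLongChord a b x y)
  InnerLongChord? a b x y = (F? x y ×-dec _ <? _ ×-dec n <? _) ×-dec _ ≤? _ ×-dec _ ≤? _ ×-dec _ <? _

  forward-cover-within : ∀ {a b p x y} → LongChord a b → a <ᶠ p → p ≤ᶠ b → Covers x y p → x <ᶠ y →
                         CoveredWithin a b p
  forward-cover-within {a} {b} {p} {x} {y} (ab , a<b , long) a<p p≤b (xy , short , 0<xp , xp≤xy) x<y
    with cw-inside (<⇒≤ x<y) 0<xp xp≤xy | laminar ab xy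
  ... | x<p , p≤y | inj₁ b≤x = ⊥-elim (<-irrefl refl (<-≤-trans x<p (≤-trans p≤b b≤x)))
  ... | x<p , p≤y | inj₂ (inj₁ y≤a) = ⊥-elim (<-irrefl refl (<-≤-trans a<p (≤-trans p≤y y≤a)))
  ... | x<p , p≤y | inj₂ (inj₂ (inj₁ (a≤x , y≤b))) = x , y , (xy , short) , a≤x , x<p , p≤y , y≤b
  ... | x<p , p≤y | inj₂ (inj₂ (inj₂ (x≤a , b≤y))) =
    ⊥-elim (<-asym long (≤-<-trans (+-mono-≤ ab≤xy ab≤xy) short))
    where ab≤xy = cw-nested x≤a (<⇒≤ a<b) b≤y

  backward-cover-inner : ∀ {a b p x y} → LongChord a b → a <ᶠ p → p ≤ᶠ b → Covers x y p → y <ᶠ x →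
                         InnerLongChord a b y x
  backward-cover-inner {a} {b} {p} {x} {y} (ab , a<b , long) a<p p≤b cov@(xy , short , 0<xp , xp≤xy) y<x
    with cw-inside-wrap y<x 0<xp xp≤xy | laminar ab (F-sym x y xy)
  ... | _ | inj₁ b≤y = ⊥-elim (long-disjoint (<⇒≤ a<b) b≤y (<⇒≤ y<x) long yx-long)
    where yx-long = short⇒flip-long (covers⇒≢ cov) short
  ... | _ | inj₂ (inj₁ x≤a) = ⊥-elim (long-disjoint (<⇒≤ y<x) x≤a (<⇒≤ a<b) yx-long long)
    where yx-long = short⇒flip-long (covers⇒≢ cov) short
  ... | outside | inj₂ (inj₂ (inj₁ (a≤y , x≤b))) =
    (F-sym x y xy , y<x , short⇒flip-long (covers⇒≢ cov) short) ,
    a≤y , x≤b , cw-nested-< a≤y (<⇒≤ y<x) x≤b (strict outside)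
    where
    strict : toℕ p ≤ toℕ y ⊎ toℕ x < toℕ p → toℕ a < toℕ y ⊎ toℕ x < toℕ b
    strict (inj₁ p≤y) = inj₁ (<-≤-trans a<p p≤y)
    strict (inj₂ x<p) = inj₂ (<-≤-trans x<p p≤b)
  ... | inj₁ p≤y | inj₂ (inj₂ (inj₂ (y≤a , _))) = ⊥-elim (<-irrefl refl (<-≤-trans a<p (≤-trans p≤y y≤a)))
  ... | inj₂ x<p | inj₂ (inj₂ (inj₂ (_ , b≤x))) = ⊥-elim (<-irrefl refl (<-≤-trans x<p (≤-trans p≤b b≤x)))

  origin : Fin n
  origin = fromℕ< (>-nonZero⁻¹ n)

  origin-cover⇒long-chord : ∀ {x y} → Covers x y origin → LongChord y x
  origin-cover⇒long-chord {x} {y} cov@(xy , short , 0<x0 , x0≤xy) with <-cmp (toℕ x) (toℕ y)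
  ... | tri≈ _ x≡y _ = ⊥-elim (covers⇒≢ cov (toℕ-injective x≡y))
  ... | tri< x<y _ _ =
    ⊥-elim (n≮0 (subst (toℕ x <_) (toℕ-fromℕ< _) (proj₁ (cw-inside (<⇒≤ x<y) 0<x0 x0≤xy))))
  ... | tri> _ _ y<x = F-sym x y xy , y<x , short⇒flip-long (covers⇒≢ cov) short

  module _ (covered : ∀ p → Σ (Fin n) λ x → Σ (Fin n) λ y → Covers x y p) where

    covered-within : ∀ {a b} → LongChord a b → (∀ x y → ¬ InnerLongChord a b x y) →
                     ∀ p → a <ᶠ p → p ≤ᶠ b → CoveredWithin a b p
    covered-within chord innermost p a<p p≤b with covered p
    ... | x , y , cov with <-cmp (toℕ x) (toℕ y)
    ...   | tri< x<y _ _ = forward-cover-within chord a<p p≤b cov x<y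
    ...   | tri≈ _ x≡y _ = ⊥-elim (covers⇒≢ cov (toℕ-injective x≡y))
    ...   | tri> _ _ y<x = ⊥-elim (innermost y x (backward-cover-inner chord a<p p≤b cov y<x))

    -- Below an innermost long chord a b, the short chords covering (a, b] form a second path from a to b.
    no-long-chord : ∀ {a b} → Acc _<_ (cw a b) → LongChord a b → ⊥
    no-long-chord {a} {b} (acc shorter) chord@(ab , a<b , long)
      with Fin.any? (λ x → Fin.any? (InnerLongChord? a b x))
    ... | yes (x , y , inner , _ , _ , xy<ab) = no-long-chord (shorter xy<ab) inner
    ... | no none = long-chord-path⇒⊥ ab long
                      (increasing-path a<b (covered-within chord λ x y inner → none (x , y , inner)))

    all-covered⇒⊥ : ⊥
    all-covered⇒⊥ = no-long-chord (<-wellFounded _) (origin-cover⇒long-chord (proj₂ (proj₂ (covered origin))))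

  free-radius : Σ (Fin n) λ p → ∀ x y → ¬ Covers x y p
  free-radius with Fin.any? (λ p → Fin.all? (λ x → Fin.all? (λ y → ¬? (Covers? x y p))))
  ... | yes free = free
  ... | no ¬free = ⊥-elim (all-covered⇒⊥ covered)
    where
    covered : ∀ p → Σ (Fin n) λ x → Σ (Fin n) λ y → Covers x y p
    covered p with Fin.any? (λ x → Fin.any? (λ y → Covers? x y p))
    ... | yes cover = cover
    ... | no ¬cover = ⊥-elim (¬free (p , λ x y cov → ¬cover (x , y , cov)))

module InvariantTree (n s : ℕ) .{{_ : NonZero n}} (0<s : 0 < s) (s+s≤n : s + s ≤ n)
                     (E : EdgeRel n) (E-sym : ∀ i j → E i j → E j i) (E-nc : NonCrossing E) (E-acyclic : Acyclic E)
                     (E-rot : ∀ i j → E i j ⇔ E (rot n s i) (rot n s j)) where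

  open Clockwise n

  s<n : s < n
  s<n = <-≤-trans (m<m+n s 0<s) s+s≤n

  rotate rotate⁻¹ : Fin n → Fin n
  rotate = rot n s
  rotate⁻¹ = rot n (n ∸ s)

  rotate-rotate⁻¹ : ∀ x → rotate (rotate⁻¹ x) ≡ x
  rotate-rotate⁻¹ = rot-inverse (m∸n+n≡m (<⇒≤ s<n))

  rotate⁻¹-rotate : ∀ x → rotate⁻¹ (rotate x) ≡ x
  rotate⁻¹-rotate = rot-inverse (m+[n∸m]≡n (<⇒≤ s<n))

  E-rotate : ∀ {i j} → E i j → E (rotate i) (rotate j)
  E-rotate {i} {j} = Equivalence.to (E-rot i j)

  E-rotate⁻¹ : ∀ {i j} → E i j → E (rotate⁻¹ i) (rotate⁻¹ j)
  E-rotate⁻¹ {i} {j} ij = Equivalence.from (E-rot _ _)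
    (subst₂ E (sym (rotate-rotate⁻¹ i)) (sym (rotate-rotate⁻¹ j)) ij)

  Conn-sym : ∀ {i j} → Conn E i j → Conn E j i
  Conn-sym = reverse (E-sym _ _)

  tree-image : ∀ v → Image rotate (Tree E v) ≐ Tree E (rotate v)
  tree-image v x = mk⇔ (λ { (u , v↝u , refl) → gmap rotate E-rotate v↝u })
    λ ρv↝x → rotate⁻¹ x
           , subst (λ u → Conn E u (rotate⁻¹ x)) (rotate⁻¹-rotate v) (gmap rotate⁻¹ E-rotate⁻¹ ρv↝x)
           , rotate-rotate⁻¹ x

  tree-fixed-or-disjoint : (∀ i j → Dec (Conn E i j)) → (v : Fin n) →
    (Image rotate (Tree E v) ≐ Tree E v)
    ⊎ (Σ (Fin n) λ w → (Image rotate (Tree E v) ≐ Tree E w) × Disjoint (Tree E w) (Tree E v))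
  tree-fixed-or-disjoint Conn? v with Conn? v (rotate v)
  ... | yes v↝ρv = inj₁ λ x → mk⇔ (λ img → v↝ρv ◅◅ Equivalence.to (tree-image v x) img)
                                  (λ v↝x → Equivalence.from (tree-image v x) (Conn-sym v↝ρv ◅◅ v↝x))
  ... | no v↛ρv = inj₂ (rotate v , tree-image v , λ x ρv↝x v↝x → v↛ρv (v↝x ◅◅ Conn-sym ρv↝x))

  fixed-tree⇒invariant : ∀ {v} → Image rotate (Tree E v) ≐ Tree E v → Conn E v (rotate v)
  fixed-tree⇒invariant {v} fixed = Equivalence.to (fixed (rotate v)) (v , ε , refl)

  TreeEdge : Fin n → EdgeRel n
  TreeEdge v x y = E x y × Tree E v x

  module _ (E? : ∀ i j → Dec (E i j)) (Conn? : ∀ i j → Dec (Conn E i j)) where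

    module _ (v : Fin n) (v↝ρv : Conn E v (rotate v)) where

      tree-rotate : ∀ {x} → Tree E v x → Tree E v (rotate x)
      tree-rotate v↝x = v↝ρv ◅◅ gmap rotate E-rotate v↝x

      tree-rotate⁻¹ : ∀ {x} → Tree E v x → Tree E v (rotate⁻¹ x)
      tree-rotate⁻¹ v↝x = v↝ρ⁻¹v ◅◅ gmap rotate⁻¹ E-rotate⁻¹ v↝x
        where
        v↝ρ⁻¹v : Conn E v (rotate⁻¹ v)
        v↝ρ⁻¹v = Conn-sym (subst (Conn E (rotate⁻¹ v)) (rotate⁻¹-rotate v)
                                 (gmap rotate⁻¹ E-rotate⁻¹ v↝ρv))

      open FreeRadius n (TreeEdge v)
        (λ x y (xy , v↝x) → E-sym x y xy , v↝x ◅◅ (xy ◅ ε))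
        (λ a b c d ab cd → E-nc a b c d (proj₁ ab) (proj₁ cd))
        (λ (a , ws , b , long , distinct , path , ba) →
           E-acyclic (a , ws , b , long , distinct , Linked.map proj₁ path , proj₁ ba))
        (λ x y → E? x y ×-dec Conn? v x)
        using (Covers; free-radius)

      rotate-free : ∀ {p} → (∀ x y → ¬ Covers x y p) → ∀ x y → ¬ Covers x y (rotate p)
      rotate-free {p} free x y ((xy , v↝x) , short , 0<xq , xq≤xy) =
        free (rotate⁻¹ x) (rotate⁻¹ y)
          ( (E-rotate⁻¹ xy , tree-rotate⁻¹ v↝x)
          , subst (λ c → c + c < n) (sym x'y'≡xy) short
          , subst (0 <_) (sym x'p≡xq) 0<xq
          , subst₂ _≤_ (sym x'p≡xq) (sym x'y'≡xy) xq≤xy)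
        where
        x'y'≡xy : cw (rotate⁻¹ x) (rotate⁻¹ y) ≡ cw x y
        x'y'≡xy = trans (sym (cw-rot s _ _)) (cong₂ cw (rotate-rotate⁻¹ x) (rotate-rotate⁻¹ y))
        x'p≡xq : cw (rotate⁻¹ x) p ≡ cw x (rotate p)
        x'p≡xq = trans (sym (cw-rot s _ p)) (cong (λ z → cw z (rotate p)) (rotate-rotate⁻¹ x))

      -- Walking backwards by s from any vertex of the tree eventually enters the sector [p, ρ p).
      sector-vertex : ∀ p {w} → Acc _<_ (cw p w) → Tree E v w → Σ (Fin n) λ u → Tree E v u × cw p u < s
      sector-vertex p {w} (acc smaller) v↝w with cw p w <? s
      ... | yes pw<s = w , v↝w , pw<s
      ... | no pw≮s = sector-vertex p {rotate⁻¹ w} (smaller (subst (cw p (rotate⁻¹ w) <_) back (m<m+n _ 0<s)))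
                                      (tree-rotate⁻¹ v↝w)
        where
        step : cw (rotate⁻¹ w) w ≡ s
        step = trans (cong (cw (rotate⁻¹ w)) (sym (rotate-rotate⁻¹ w))) (cw-rot-self s<n (rotate⁻¹ w))
        back : cw p (rotate⁻¹ w) + s ≡ cw p w
        back = trans (cong (cw p (rotate⁻¹ w) +_) (sym step))
                     (cw-+ʳ p (rotate⁻¹ w) w (subst (_≤ cw p w) (sym step) (≮⇒≥ pw≮s)))

      -- The tree joins the sector [p, ρ p) to its rotated copy, so one of its edges leaves the sector;
      -- unless that edge is a diameter, its shorter arc covers p or ρ p.
      no-diameter⇒⊥ : (∀ x y → TreeEdge v x y → ¬ Diameter x y) → ⊥
      no-diameter⇒⊥ ¬diameter =
        leaving-edge⇒⊥ (escaping-step InSector (λ z → _ <? s) w↝ρw pw<s ρw∉sector)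
        where
        p = proj₁ free-radius
        free = proj₂ free-radius
        InSector : Fin n → Set
        InSector z = cw p z < s
        start = sector-vertex p (<-wellFounded _) ε
        w = proj₁ start
        v↝w = proj₁ (proj₂ start)
        pw<s = proj₂ (proj₂ start)
        w↝ρw : Conn E w (rotate w)
        w↝ρw = Conn-sym v↝w ◅◅ tree-rotate v↝w
        ρw∉sector : ¬ InSector (rotate w)
        ρw∉sector = ≤⇒≯ (subst (s ≤_) pw+s≡pρw (m≤n+m s (cw p w)))
          where
          pw+s≡pρw : cw p w + s ≡ cw p (rotate w)
          pw+s≡pρw = trans (cong (cw p w +_) (sym (cw-rot-self s<n w)))
            (cw-+-small p w (rotate w) (subst (λ c → cw p w + c < n) (sym (cw-rot-self s<n w))
                                                (<-≤-trans (+-monoˡ-< s pw<s) s+s≤n)))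
        leaving-edge⇒⊥ : Σ (Fin n) (λ x → Σ (Fin n) λ y → Star E w x × E x y × InSector x × ¬ InSector y) →
                         ⊥
        leaving-edge⇒⊥ (x , y , w↝x , xy , px<s , py≮s) =
          covers (short-or-short x≢y (¬diameter x y (xy , v↝x)))
          where
          v↝x = v↝w ◅◅ w↝x
          px<py = <-≤-trans px<s (≮⇒≥ py≮s)
          x≢y : x ≢ y
          x≢y refl = <-irrefl refl px<py
          covers : Short x y ⊎ Short y x → ⊥
          covers (inj₁ short) = rotate-free free x y ((xy , v↝x) , short ,
            cw-between {p} {x} {rotate p} {y} (subst (cw p x <_) (sym (cw-rot-self s<n p)) px<s)
                       (subst (_≤ cw p y) (sym (cw-rot-self s<n p)) (≮⇒≥ py≮s)))
          covers (inj₂ short) =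
            free y x ((E-sym x y xy , v↝x ◅◅ (xy ◅ ε)) , short , cw-between-flip {p} {x} {y} px<py)

      diameter : Σ (Fin n) λ x → Σ (Fin n) λ y → TreeEdge v x y × Diameter x y
      diameter with Fin.any? (λ x → Fin.any? (λ y → (E? x y ×-dec Conn? v x) ×-dec (_ ≟ n)))
      ... | yes found = found
      ... | no none = ⊥-elim (no-diameter⇒⊥ λ x y xy d → none (x , y , xy , d))

    invariant-tree⇒half-turn : ∀ {v} → Conn E v (rotate v) → s + s ≡ n
    invariant-tree⇒half-turn {v} v↝ρv with m≤n⇒m<n∨m≡n s+s≤n
    ... | inj₂ s+s≡n = s+s≡n
    ... | inj₁ s+s<n = ⊥-elim (rotated-diameter-crosses (diameter v v↝ρv))
      where
      rotated-diameter-crosses : Σ (Fin n) (λ x → Σ (Fin n) λ y → TreeEdge v x y × Diameter x y) → ⊥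
      rotated-diameter-crosses (x , y , (xy , _) , xy-diam) =
        diameters-cross E-sym E-nc xy xy-diam (E-rotate xy) ρxy-diam x≢ρx y≢ρx
        where
        ρxy-diam : Diameter (rotate x) (rotate y)
        ρxy-diam = subst (λ c → c + c ≡ n) (sym (cw-rot s x y)) xy-diam
        x≢ρx : x ≢ rotate x
        x≢ρx x≡ρx = <⇒≢ 0<s (trans (sym (cw-self x)) (trans (cong (cw x) x≡ρx) (cw-rot-self s<n x)))
        y≢ρx : y ≢ rotate x
        y≢ρx y≡ρx = <⇒≢ s+s<n (subst (λ c → c + c ≡ n) (trans (cong (cw x) y≡ρx) (cw-rot-self s<n x)) xy-diam)

    invariant-trees-connected : ∀ {v w} → Conn E v (rotate v) → Conn E w (rotate w) → Conn E v w
    invariant-trees-connected {v} {w} v↝ρv w↝ρw with Conn? v w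
    ... | yes v↝w = v↝w
    ... | no v↛w = ⊥-elim (diameters-meet (diameter v v↝ρv) (diameter w w↝ρw))
      where
      diameters-meet : Σ (Fin n) (λ x → Σ (Fin n) λ x' → TreeEdge v x x' × Diameter x x') →
                       Σ (Fin n) (λ y → Σ (Fin n) λ y' → TreeEdge w y y' × Diameter y y') → ⊥
      diameters-meet (x , x' , (xx' , v↝x) , x-diam) (y , y' , (yy' , w↝y) , y-diam) =
        diameters-cross E-sym E-nc xx' x-diam yy' y-diam
          (λ { refl → v↛w (v↝x ◅◅ Conn-sym w↝y) })
          (λ { refl → v↛w (v↝x ◅◅ (xx' ◅ Conn-sym w↝y)) })

𝟙 : ∀ {P : Set} → Dec P → ℕ
𝟙 (yes _) = 1
𝟙 (no _) = 0

𝟙-yes : ∀ {P : Set} (P? : Dec P) → P → 𝟙 P? ≡ 1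
𝟙-yes (yes _) _ = refl
𝟙-yes (no ¬p) p = contradiction p ¬p

𝟙-no : ∀ {P : Set} (P? : Dec P) → ¬ P → 𝟙 P? ≡ 0
𝟙-no (yes p) ¬p = contradiction p ¬p
𝟙-no (no _) _ = refl

sum-ones : ∀ k → sum {k} (λ _ → 1) ≡ k
sum-ones zero = refl
sum-ones (suc k) = cong suc (sum-ones k)

-- The points t < σ t and the points σ t < t are exchanged by σ, so they are equally many.
involution-unique-fixed-point⇒odd : ∀ {k} (σ : Fin k → Fin k) → (∀ t → σ (σ t) ≡ t) →
                                     ∀ t₀ → σ t₀ ≡ t₀ → (∀ t → σ t ≡ t → t ≡ t₀) → k % 2 ≡ 1
involution-unique-fixed-point⇒odd {suc k} σ σσ t₀ σt₀≡t₀ fixed⇒t₀ = begin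
  suc k % 2                                    ≡⟨ cong (_% 2) (sum-ones (suc k)) ⟨
  sum {suc k} (λ _ → 1) % 2                    ≡⟨ cong (_% 2) (sum-cong-≗ (sym ∘ trichotomy)) ⟩
  sum (λ t → up t + down t + fixed t) % 2      ≡⟨ cong (_% 2) (∑-distrib-+ (λ t → up t + down t) fixed) ⟩
  (sum (λ t → up t + down t) + sum fixed) % 2  ≡⟨ cong (λ m → (m + sum fixed) % 2) (∑-distrib-+ up down) ⟩
  (sum up + sum down + sum fixed) % 2          ≡⟨ cong₂ (λ a b → (sum up + a + b) % 2)
                                                        (sym up≡down) one-fixed ⟩
  (sum up + sum up + 1) % 2                    ≡⟨ cong (_% 2) (double+1 (sum up)) ⟩
  (1 + sum up * 2) % 2                         ≡⟨ [m+kn]%n≡m%n 1 (sum up) 2 ⟩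
  1                                            ∎
  where
  open ≡-Reasoning
  double+1 : ∀ a → a + a + 1 ≡ 1 + a * 2
  double+1 = solve-∀
  up down fixed : Fin (suc k) → ℕ
  up t = 𝟙 (toℕ t <? toℕ (σ t))
  down t = 𝟙 (toℕ (σ t) <? toℕ t)
  fixed t = 𝟙 (σ t Fin.≟ t)
  trichotomy : ∀ t → up t + down t + fixed t ≡ 1
  trichotomy t with <-cmp (toℕ t) (toℕ (σ t))
  ... | tri< t<σt _ σt≮t =
    cong₂ _+_ (cong₂ _+_ (𝟙-yes (toℕ t <? _) t<σt) (𝟙-no (toℕ (σ t) <? _) σt≮t))
              (𝟙-no (σ t Fin.≟ t) λ σt≡t → <⇒≢ t<σt (cong toℕ (sym σt≡t)))
  ... | tri≈ t≮σt t≡σt σt≮t =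
    cong₂ _+_ (cong₂ _+_ (𝟙-no (toℕ t <? _) t≮σt) (𝟙-no (toℕ (σ t) <? _) σt≮t))
              (𝟙-yes (σ t Fin.≟ t) (toℕ-injective (sym t≡σt)))
  ... | tri> t≮σt _ σt<t =
    cong₂ _+_ (cong₂ _+_ (𝟙-no (toℕ t <? _) t≮σt) (𝟙-yes (toℕ (σ t) <? _) σt<t))
              (𝟙-no (σ t Fin.≟ t) λ σt≡t → <⇒≢ σt<t (cong toℕ σt≡t))
  up≡down : sum up ≡ sum down
  up≡down = trans (sum-permute up (permutation σ σ σσ σσ))
                  (sum-cong-≗ λ t → cong (λ u → 𝟙 (toℕ (σ t) <? toℕ u)) (σσ t))
  one-fixed : sum fixed ≡ 1
  one-fixed = begin
    sum fixed                                 ≡⟨ sum-remove {i = t₀} fixed ⟩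
    fixed t₀ + sum (fixed ∘ Fin.punchIn t₀)   ≡⟨ cong₂ _+_ (𝟙-yes (σ t₀ Fin.≟ t₀) σt₀≡t₀)
                                                           (sum-cong-≗ moved) ⟩
    1 + sum {k} (λ _ → 0)                     ≡⟨ cong suc (sum-replicate-zero k) ⟩
    1                                         ∎
    where
    moved : ∀ j → fixed (Fin.punchIn t₀ j) ≡ 0
    moved j = 𝟙-no (σ _ Fin.≟ _) (Fin.punchInᵢ≢i t₀ j ∘ fixed⇒t₀ _)

odd-components : ∀ {n k} {E : EdgeRel n} → HasComponents E k → (f : Fin n → Fin n) →
                 (∀ {i j} → E i j → E (f i) (f j)) → (∀ x → f (f x) ≡ x) →
                 ∀ {v} → Conn E v (f v) → (∀ {w} → Conn E w (f w) → Conn E v w) → k % 2 ≡ 1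
odd-components {n} {E = E} (c , c-conn , c-onto) f E-f ff {v} v↝fv invariant⇒v↝ =
  involution-unique-fixed-point⇒odd σ σσ (c v) σcv≡cv fixed⇒cv
  where
  same⇒conn : ∀ {i j} → c i ≡ c j → Conn E i j
  same⇒conn {i} {j} = Equivalence.to (c-conn i j)
  conn⇒same : ∀ {i j} → Conn E i j → c i ≡ c j
  conn⇒same {i} {j} = Equivalence.from (c-conn i j)
  rep : Fin _ → Fin n
  rep t = proj₁ (c-onto t)
  c-rep : ∀ t → c (rep t) ≡ t
  c-rep t = proj₂ (c-onto t)
  σ : Fin _ → Fin _
  σ t = c (f (rep t))
  σ-c : ∀ u → σ (c u) ≡ c (f u)
  σ-c u = conn⇒same (gmap f E-f (same⇒conn (c-rep (c u))))
  σσ : ∀ t → σ (σ t) ≡ t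
  σσ t = trans (σ-c (f (rep t))) (trans (cong c (ff (rep t))) (c-rep t))
  σcv≡cv : σ (c v) ≡ c v
  σcv≡cv = trans (σ-c v) (sym (conn⇒same v↝fv))
  fixed⇒cv : ∀ t → σ t ≡ t → t ≡ c v
  fixed⇒cv t σt≡t =
    trans (sym (c-rep t)) (sym (conn⇒same (invariant⇒v↝ (same⇒conn (trans (c-rep t) (sym σt≡t))))))

lemma3p1 : (n k d : ℕ) .{{_ : NonZero n}} .{{_ : NonZero d}} → 1 ≤ k → 2 ≤ d → d ∣ n →
    (E : EdgeRel n) → NonCrossingForest E → HasComponents E k → Invariant n d E →
    ((v : Fin n) →
       (Image (ρ n d) (Tree E v) ≐ Tree E v)
       ⊎ (Σ (Fin n) λ w → (Image (ρ n d) (Tree E v) ≐ Tree E w) × Disjoint (Tree E w) (Tree E v)))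
    × ((v : Fin n) → Image (ρ n d) (Tree E v) ≐ Tree E v → (d ≡ 2) × (k % 2 ≡ 1))
lemma3p1 n k d _ 2≤d d∣n E ((E-sym , _) , E-nc , E-acyclic) components invariant =
  tree-fixed-or-disjoint Conn? , λ v fixed → decidable-stable (d ≟ 2 ×-dec k % 2 ≟ 1) λ ¬goal →
    ¬¬-Decidable-Fin E λ E? →
      let v↝ρv = fixed-tree⇒invariant fixed
          s+s≡n = invariant-tree⇒half-turn E? Conn? v↝ρv
      in ¬goal ( *-cancelˡ-≡ d 2 s {{>-nonZero 0<s}} (trans s*d≡n (sym (trans (m*2≡m+m s) s+s≡n)))
               , odd-components components rotate E-rotate (rot-inverse s+s≡n) v↝ρv
                                (invariant-trees-connected E? Conn? v↝ρv))
  where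
  s = n / d
  s*d≡n : s * d ≡ n
  s*d≡n = m/n*n≡m d∣n
  0<s : 0 < s
  0<s = m≥n⇒m/n>0 (∣⇒≤ d∣n)
  open InvariantTree n s 0<s (subst₂ _≤_ (m*2≡m+m s) s*d≡n (*-monoʳ-≤ s 2≤d))
                     E E-sym E-nc E-acyclic invariant
  open Clockwise n using (rot-inverse)
  Conn? = components⇒Conn? components
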